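{- Let $\langle\phi,G,S,S'\rangle$ be a yes-instance of MSOR$_1$ with $|S|=|S'|=k$, where $G=(V,E,\mathcal{C})$. Let $C_1,\dots,C_t$ be a family of pairwise disjoint vertex sets of $G$ that all have the same type and do not intersect $S\cup S'$. If $t>k$, then for every $I\subseteq[t]$ with $|I|=k$, there is a shortest $\mathsf{TJ}(\phi)$-sequence $S_0,\dots,S_\ell$ from $S_0=S$ to $S_\ell=S'$ such that $C_i\cap\bigcup_{0\le j\le\ell}S_j\ne\emptyset$ only if $i\in I$.
   Context: A colored graph is $G=(V,E,\mathcal{C})$ with $\mathcal{C}=\langle C_1,\dots,C_c\rangle$ a tuple of subsets of $V$ (colors). An isomorphism of colored graphs is a bijection preserving adjacency and non-adjacency and membership in each color. MSO$_1$ formulas use vertex and vertex-set variables, atomic formulas $x=y$, $E(x,y)$, color predicates, $X(x)$, Boolean connectives and quantification. For an MSO$_1$ formula $\phi(X)$ with one free vertex-set variable, a $\mathsf{TJ}(\phi)$-sequence from $S_0$ to $S_\ell$ (of length $\ell$) is a sequence $S_0,\dots,S_\ell$ of vertex subsets with $|S_{i-1}\setminus S_i|=|S_i\setminus S_{i-1}|=1$ for $i\in[\ell]$ and $G\models\phi(S_i)$ for all $i$; shortest means minimum length. An instance $\langle\phi,G,S,S'\rangle$ of MSOR$_1$ consists of such $\phi$, a colored graph $G$, and $S,S'\subseteq V$ with $|S|=|S'|$, $G\models\phi(S)$, $G\models\phi(S')$; it is a yes-instance if a $\mathsf{TJ}(\phi)$-sequence from $S$ to $S'$ exists. Vertex sets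 $X,X'\subseteq V$ have the same type if there is an isomorphism $\eta$ from $G$ to itself with $\eta(X)=X'$, $\eta(X')=X$ and $\eta(v)=v$ for every $v\notin X\cup X'$; a family of sets has the same type if every two of them do. -}

module Defs where

open import Data.Nat using (ℕ; zero; suc; _≤_; _<_)
open import Data.Bool using (Bool; true; false; not; _∧_; _∨_)
open import Data.Fin using (Fin)
open import Data.Fin.Properties using () renaming (_≟_ to _≟ᶠ_)
open import Data.Vec using (Vec; []; _∷_; lookup)
open import Data.List using (List; []; _∷_; map; _++_; allFin)
open import Data.Bool.ListAction using (any; all)
open import Data.Fin.Subset using (Subset; Side; inside; outside; _∈_; _∪_; _∩_; _─_; ∣_∣; ⊥)
open import Data.Fin.Permutation using (Permutation′; _⟨$⟩ʳ_)
open import Data.Product using (Σ; _×_; ∃)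
open import Relation.Binary.PropositionalEquality using (_≡_; _≢_)
open import Relation.Nullary.Decidable using (⌊_⌋)

record ColoredGraph (n c : ℕ) : Set where
  field
    adj   : Fin n → Fin n → Bool
    sym   : ∀ u v → adj u v ≡ adj v u
    irr   : ∀ v → adj v v ≡ false
    color : Fin c → Subset n

open ColoredGraph public

-- MSO₁ formulas over c color predicates, with (de Bruijn) a free vertex
-- variables and b free vertex-set variables.

data Form (c : ℕ) : ℕ → ℕ → Set where
  eq     : ∀ {a b} → Fin a → Fin a → Form c a b
  edge   : ∀ {a b} → Fin a → Fin a → Form c a b
  col    : ∀ {a b} → Fin c → Fin a → Form c a b
  mem    : ∀ {a b} → Fin b → Fin a → Form c a b
  ¬f     : ∀ {a b} → Form c a b → Form c a b
  _∧f_   : ∀ {a b} → Form c a b → Form c a b → Form c a b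
  _∨f_   : ∀ {a b} → Form c a b → Form c a b → Form c a b
  ∃v     : ∀ {a b} → Form c (suc a) b → Form c a b
  ∀v     : ∀ {a b} → Form c (suc a) b → Form c a b
  ∃s     : ∀ {a b} → Form c a (suc b) → Form c a b
  ∀s     : ∀ {a b} → Form c a (suc b) → Form c a b

isIn : ∀ {n} → Fin n → Subset n → Bool
isIn v p with lookup p v
... | inside  = true
... | outside = false

allSubsets : (n : ℕ) → List (Subset n)
allSubsets zero    = [] ∷ []
allSubsets (suc n) = map (inside ∷_) (allSubsets n) ++ map (outside ∷_) (allSubsets n)

eval : ∀ {n c a b} → ColoredGraph n c → Form c a b →
       Vec (Fin n) a → Vec (Subset n) b → Bool
eval G (eq x y)   ρ σ = ⌊ lookup ρ x ≟ᶠ lookup ρ y ⌋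
eval G (edge x y) ρ σ = adj G (lookup ρ x) (lookup ρ y)
eval G (col j x)  ρ σ = isIn (lookup ρ x) (color G j)
eval G (mem X x)  ρ σ = isIn (lookup ρ x) (lookup σ X)
eval G (¬f φ)     ρ σ = not (eval G φ ρ σ)
eval G (φ ∧f ψ)   ρ σ = eval G φ ρ σ ∧ eval G ψ ρ σ
eval G (φ ∨f ψ)   ρ σ = eval G φ ρ σ ∨ eval G ψ ρ σ
eval {n} G (∃v φ) ρ σ = any (λ v → eval G φ (v ∷ ρ) σ) (allFin n)
eval {n} G (∀v φ) ρ σ = all (λ v → eval G φ (v ∷ ρ) σ) (allFin n)
eval {n} G (∃s φ) ρ σ = any (λ X → eval G φ ρ (X ∷ σ)) (allSubsets n)
eval {n} G (∀s φ) ρ σ = all (λ X → eval G φ ρ (X ∷ σ)) (allSubsets n)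

_⊨_[_] : ∀ {n c} → ColoredGraph n c → Form c 0 1 → Subset n → Set
G ⊨ φ [ X ] = eval G φ [] (X ∷ []) ≡ true

-- TJ(φ)-sequences S₀,…,S_ℓ, represented as σ : ℕ → Subset n (only the
-- values σ 0,…,σ ℓ matter).

record IsTJSeq {n c} (G : ColoredGraph n c) (φ : Form c 0 1)
               (S S' : Subset n) (ℓ : ℕ) (σ : ℕ → Subset n) : Set where
  field
    start : σ 0 ≡ S
    end   : σ ℓ ≡ S'
    step₁ : ∀ i → i < ℓ → ∣ σ i ─ σ (suc i) ∣ ≡ 1
    step₂ : ∀ i → i < ℓ → ∣ σ (suc i) ─ σ i ∣ ≡ 1
    sat   : ∀ i → i ≤ ℓ → G ⊨ φ [ σ i ]

IsShortestTJSeq : ∀ {n c} (G : ColoredGraph n c) (φ : Form c 0 1)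
                  (S S' : Subset n) (ℓ : ℕ) (σ : ℕ → Subset n) → Set
IsShortestTJSeq G φ S S' ℓ σ =
  IsTJSeq G φ S S' ℓ σ ×
  (∀ ℓ' σ' → IsTJSeq G φ S S' ℓ' σ' → ℓ ≤ ℓ')

record MSOR1Instance {n c} (G : ColoredGraph n c) (φ : Form c 0 1)
                     (S S' : Subset n) : Set where
  field
    sameSize : ∣ S ∣ ≡ ∣ S' ∣
    satS     : G ⊨ φ [ S ]
    satS'    : G ⊨ φ [ S' ]

YesInstance : ∀ {n c} (G : ColoredGraph n c) (φ : Form c 0 1)
              (S S' : Subset n) → Set
YesInstance G φ S S' =
  MSOR1Instance G φ S S' × ∃ λ ℓ → ∃ λ σ → IsTJSeq G φ S S' ℓ σ

record IsAutomorphism {n c} (G : ColoredGraph n c) (η : Permutation′ n) : Set where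
  field
    pres-adj : ∀ u v → adj G (η ⟨$⟩ʳ u) (η ⟨$⟩ʳ v) ≡ adj G u v
    pres-col : ∀ j v → lookup (color G j) (η ⟨$⟩ʳ v) ≡ lookup (color G j) v

-- η(X) = X' written pointwise (η is a bijection): v ∈ X ⇔ η v ∈ X'.
SameType : ∀ {n c} (G : ColoredGraph n c) (X X' : Subset n) → Set
SameType {n} G X X' = Σ (Permutation′ n) λ η →
  IsAutomorphism G η ×
  (∀ v → lookup X' (η ⟨$⟩ʳ v) ≡ lookup X v) ×
  (∀ v → lookup X (η ⟨$⟩ʳ v) ≡ lookup X' v) ×
  (∀ v → lookup (X ∪ X') v ≡ outside → η ⟨$⟩ʳ v ≡ v)

-- Walk along a shortest TJ(φ)-sequence S₀,…,S_ℓ, keeping the invariant that S₀,…,S_j avoid every C i with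
-- i ∉ I. If the jump S_j → S_{j+1} removes u and adds w ∈ C i with i ∉ I, then S_j ∖ {u} has k − 1 elements and
-- so misses one of the k disjoint sets C b with b ∈ I. The automorphism η exchanging C i and C b fixes S_j ∖ {u}
-- and S' pointwise, and automorphisms preserve MSO₁ truth, so replacing S_{j+1},…,S_ℓ by their images under η
-- gives a TJ(φ)-sequence from S to S' that jumps from S_j to (S_j ∖ {u}) ∪ {η w}, with η w ∈ C b. If η w = u this
-- sequence visits S_j twice, contradicting shortness; otherwise it has length ℓ and satisfies the invariant up to
-- j + 1. A shortest sequence exists because reachability in m jumps is decidable (all sets involved are finite).

module Submission where

open import Defs hiding (sym)
open import Data.Bool using (Bool; true; T; not; _∧_; _∨_)
open import Data.Bool.ListAction using (any; all)
open import Data.Bool.Properties using (T-≡; ⇔→≡) renaming (_≟_ to _≟ᵇ_)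
open import Data.Empty using (⊥-elim)
open import Data.Fin using (Fin; zero; suc)
open import Data.Fin.Permutation using (Permutation′; _⟨$⟩ʳ_; _⟨$⟩ˡ_; inverseˡ; inverseʳ; flip)
open import Data.Fin.Properties using (any?; suc-injective) renaming (_≟_ to _≟ᶠ_)
open import Data.Fin.Subset using (Subset; inside; outside; _∈_; _∉_; _∪_; _∩_; _─_; _-_; ⁅_⁆; ∣_∣; ⊥)
open import Data.Fin.Subset.Properties
  using ( _∈?_; anySubset?; ⊆-antisym; ∉⊥; x∈⁅x⁆; x∈⁅y⁆⇒x≡y; ∣⁅x⁆∣≡1; x∈p∪q⁺; x∈p∪q⁻; x∈p∩q⁺
        ; p─q⊆p; x∈p∧x∉q⇒x∈p─q; x∈p∧x≢y⇒x∈p-y; x∈p⇒∣p-x∣<∣p∣)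
open import Data.List using (List)
import Data.List as List
open import Data.List.Membership.Propositional using () renaming (_∈_ to _∈ₗ_)
open import Data.List.Membership.Propositional.Properties using (∈-allFin; ∈-map⁺; ∈-++⁺ˡ; ∈-++⁺ʳ)
import Data.List.Relation.Unary.All as All
open import Data.List.Relation.Unary.All.Properties using (all⁺; all⁻)
import Data.List.Relation.Unary.Any as Any
open import Data.List.Relation.Unary.Any.Properties using (any⁺; any⁻)
open import Data.Nat using (ℕ; zero; suc; pred; _+_; _≤_; _<_; z≤n; s≤s; _≟_)
open import Data.Nat.Properties
  using ( ≤-refl; ≤-trans; ≤-pred; <⇒≤; <-≤-trans; ≮⇒≥; 1+n≰n; m≤m+n; n≤1+n; m≤n⇒∃[o]m+o≡n
        ; m≤n⇒m<n∨m≡n; m<1+n⇒m<n∨m≡n; +-suc; +-comm; +-cancelʳ-≡; +-monoˡ-<; +-monoˡ-≤)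
open import Data.Product using (∃; ∃₂; _×_; _,_; proj₁; proj₂)
open import Data.Sum using (_⊎_; inj₁; inj₂; [_,_]′; map₁)
open import Data.Vec using ([]; _∷_; here; there; lookup; tabulate; zipWith)
import Data.Vec as Vec
open import Data.Vec.Properties using (≡-dec; lookup-map; lookup∘tabulate; lookup-zipWith; []=⇒lookup; lookup⇒[]=)
open import Data.Vec.Relation.Binary.Pointwise.Extensional using (ext; Pointwise-≡⇒≡)
open import Function using (_∘_; const; _⇔_; mk⇔; Equivalence)
open import Relation.Binary.PropositionalEquality
  using (_≡_; _≢_; refl; sym; trans; cong; cong₂; subst; module ≡-Reasoning)
open import Relation.Nullary using (Dec; yes; no; ¬_)
open import Relation.Nullary.Decidable using (⌊_⌋; isYes≗does; does-⇔; map′; _×-dec_; ¬?; decidable-stable)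

open Equivalence using (to; from)

-- Quantifiers over exhaustive lists

module _ {A : Set} {xs : List A} (complete : ∀ x → x ∈ₗ xs) where

  T-any⇔∃ : ∀ p → T (any p xs) ⇔ ∃ (T ∘ p)
  T-any⇔∃ p = mk⇔ (Any.satisfied ∘ any⁻ p xs)
    (λ (x , px) → any⁺ p (Any.map (λ x≡y → subst (T ∘ p) x≡y px) (complete x)))

  T-all⇔∀ : ∀ p → T (all p xs) ⇔ (∀ x → T (p x))
  T-all⇔∀ p = mk⇔ (λ h x → All.lookup (all⁺ p xs h) (complete x))
    (λ h → all⁻ p {xs = xs} (All.tabulate (λ {x} _ → h x)))

  module _ {f g : A → Bool} (π π⁻ : A → A) (section : ∀ x → π (π⁻ x) ≡ x)
           (f∘π≗g : ∀ x → f (π x) ≡ g x) where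

    private
      T-f⇒T-g : ∀ x → T (f x) → T (g (π⁻ x))
      T-f⇒T-g x = subst T (trans (cong f (sym (section x))) (f∘π≗g (π⁻ x)))

      T-g⇒T-f : ∀ x → T (g x) → T (f (π x))
      T-g⇒T-f x = subst T (sym (f∘π≗g x))

      T⇔⇒≡ : ∀ {a b} → T a ⇔ T b → a ≡ b
      T⇔⇒≡ a⇔b = ⇔→≡ (mk⇔ (to T-≡ ∘ to a⇔b ∘ from T-≡) (to T-≡ ∘ from a⇔b ∘ from T-≡))

    any-reindex : any f xs ≡ any g xs
    any-reindex = T⇔⇒≡ (mk⇔
      (λ h → let x , fx = to (T-any⇔∃ f) h in from (T-any⇔∃ g) (π⁻ x , T-f⇒T-g x fx))
      (λ h → let x , gx = to (T-any⇔∃ g) h in from (T-any⇔∃ f) (π x , T-g⇒T-f x gx)))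

    all-reindex : all f xs ≡ all g xs
    all-reindex = T⇔⇒≡ (mk⇔
      (λ h → from (T-all⇔∀ g) (λ x → subst T (f∘π≗g x) (to (T-all⇔∀ f) h (π x))))
      (λ h → from (T-all⇔∀ f) (λ x → subst T (cong f (section x)) (T-g⇒T-f (π⁻ x) (to (T-all⇔∀ g) h (π⁻ x))))))

∈-allSubsets : ∀ {n} (X : Subset n) → X ∈ₗ allSubsets n
∈-allSubsets [] = Any.here refl
∈-allSubsets (inside ∷ X) = ∈-++⁺ˡ (∈-map⁺ (inside ∷_) (∈-allSubsets X))
∈-allSubsets {suc n} (outside ∷ X) =
  ∈-++⁺ʳ (List.map (inside ∷_) (allSubsets n)) (∈-map⁺ (outside ∷_) (∈-allSubsets X))

-- Finite sets and single exchanges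

∉⇒lookup≡outside : ∀ {n} {x : Fin n} {p : Subset n} → x ∉ p → lookup p x ≡ outside
∉⇒lookup≡outside {x = x} {p} x∉p with lookup p x in eq
... | inside  = ⊥-elim (x∉p (lookup⇒[]= x p eq))
... | outside = refl

x∈p─q⇒x∉q : ∀ {n} {x : Fin n} (p q : Subset n) → x ∈ p ─ q → x ∉ q
x∈p─q⇒x∉q (_ ∷ p) (outside ∷ q) (there x∈p─q) (there x∈q) = x∈p─q⇒x∉q p q x∈p─q x∈q
x∈p─q⇒x∉q (_ ∷ p) (inside ∷ q) (there x∈p─q) (there x∈q) = x∈p─q⇒x∉q p q x∈p─q x∈q

∣p∣+∣q─p∣≡∣q∣+∣p─q∣ : ∀ {n} (p q : Subset n) → ∣ p ∣ + ∣ q ─ p ∣ ≡ ∣ q ∣ + ∣ p ─ q ∣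
∣p∣+∣q─p∣≡∣q∣+∣p─q∣ []            []            = refl
∣p∣+∣q─p∣≡∣q∣+∣p─q∣ (inside ∷ p)  (inside ∷ q)  = cong suc (∣p∣+∣q─p∣≡∣q∣+∣p─q∣ p q)
∣p∣+∣q─p∣≡∣q∣+∣p─q∣ (inside ∷ p)  (outside ∷ q) =
  trans (cong suc (∣p∣+∣q─p∣≡∣q∣+∣p─q∣ p q)) (sym (+-suc ∣ q ∣ ∣ p ─ q ∣))
∣p∣+∣q─p∣≡∣q∣+∣p─q∣ (outside ∷ p) (inside ∷ q)  =
  trans (+-suc ∣ p ∣ ∣ q ─ p ∣) (cong suc (∣p∣+∣q─p∣≡∣q∣+∣p─q∣ p q))
∣p∣+∣q─p∣≡∣q∣+∣p─q∣ (outside ∷ p) (outside ∷ q) = ∣p∣+∣q─p∣≡∣q∣+∣p─q∣ p q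

∣p∣≡0⇒p≡⊥ : ∀ {n} {p : Subset n} → ∣ p ∣ ≡ 0 → p ≡ ⊥
∣p∣≡0⇒p≡⊥ {p = []}          _  = refl
∣p∣≡0⇒p≡⊥ {p = outside ∷ p} ∣p∣≡0 = cong (outside ∷_) (∣p∣≡0⇒p≡⊥ ∣p∣≡0)

∣p∣≡1⇒p≡⁅x⁆ : ∀ {n} {p : Subset n} → ∣ p ∣ ≡ 1 → ∃ λ x → p ≡ ⁅ x ⁆
∣p∣≡1⇒p≡⁅x⁆ {p = inside ∷ p}  ∣p∣≡1 = zero , cong (inside ∷_) (∣p∣≡0⇒p≡⊥ (cong pred ∣p∣≡1))
∣p∣≡1⇒p≡⁅x⁆ {p = outside ∷ p} ∣p∣≡1 with ∣p∣≡1⇒p≡⁅x⁆ {p = p} ∣p∣≡1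
... | x , refl = suc x , refl

[p─[p─q]]∪[q─p]≡q : ∀ {n} (p q : Subset n) → (p ─ (p ─ q)) ∪ (q ─ p) ≡ q
[p─[p─q]]∪[q─p]≡q []            []            = refl
[p─[p─q]]∪[q─p]≡q (inside ∷ p)  (inside ∷ q)  = cong (inside ∷_) ([p─[p─q]]∪[q─p]≡q p q)
[p─[p─q]]∪[q─p]≡q (inside ∷ p)  (outside ∷ q) = cong (outside ∷_) ([p─[p─q]]∪[q─p]≡q p q)
[p─[p─q]]∪[q─p]≡q (outside ∷ p) (inside ∷ q)  = cong (inside ∷_) ([p─[p─q]]∪[q─p]≡q p q)
[p─[p─q]]∪[q─p]≡q (outside ∷ p) (outside ∷ q) = cong (outside ∷_) ([p─[p─q]]∪[q─p]≡q p q)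

p≡⁅x⁆ : ∀ {n} {x : Fin n} {p : Subset n} → x ∈ p → (∀ {y} → y ∈ p → y ≡ x) → p ≡ ⁅ x ⁆
p≡⁅x⁆ {x = x} x∈p unique = ⊆-antisym (λ y∈p → subst (_∈ ⁅ x ⁆) (sym (unique y∈p)) (x∈⁅x⁆ x))
                                       (λ {y} y∈⁅x⁆ → subst (_∈ _) (sym (x∈⁅y⁆⇒x≡y x y∈⁅x⁆)) x∈p)

infix 8 _[_↦_]

_[_↦_] : ∀ {n} → Subset n → Fin n → Fin n → Subset n
A [ u ↦ w ] = (A - u) ∪ ⁅ w ⁆

module _ {n} {A : Subset n} {u w : Fin n} where

  ∈-↦⁻ : ∀ {v} → v ∈ A [ u ↦ w ] → (v ∈ A × v ≢ u) ⊎ v ≡ w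
  ∈-↦⁻ v∈ with x∈p∪q⁻ (A - u) ⁅ w ⁆ v∈
  ... | inj₁ v∈A-u = inj₁ (p─q⊆p A ⁅ u ⁆ v∈A-u ,
                           λ { refl → x∈p─q⇒x∉q A ⁅ u ⁆ v∈A-u (x∈⁅x⁆ u) })
  ... | inj₂ v∈⁅w⁆ = inj₂ (x∈⁅y⁆⇒x≡y w v∈⁅w⁆)

  ∈-↦⁺ : ∀ {v} → v ∈ A → v ≢ u → v ∈ A [ u ↦ w ]
  ∈-↦⁺ v∈A v≢u = x∈p∪q⁺ (inj₁ (x∈p∧x≢y⇒x∈p-y v∈A v≢u))

  ∈-↦-new : w ∈ A [ u ↦ w ]
  ∈-↦-new = x∈p∪q⁺ (inj₂ (x∈⁅x⁆ w))

↦-self : ∀ {n} {A : Subset n} {u} → u ∈ A → A [ u ↦ u ] ≡ A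
↦-self {A = A} {u} u∈A = ⊆-antisym ⊆A ⊇A
  where
  ⊆A : ∀ {v} → v ∈ A [ u ↦ u ] → v ∈ A
  ⊆A v∈ with ∈-↦⁻ v∈
  ... | inj₁ (v∈A , _) = v∈A
  ... | inj₂ refl      = u∈A
  ⊇A : ∀ {v} → v ∈ A → v ∈ A [ u ↦ u ]
  ⊇A {v} v∈A with v ≟ᶠ u
  ... | yes refl = ∈-↦-new
  ... | no v≢u   = ∈-↦⁺ v∈A v≢u

record Jump {n} (A B : Subset n) : Set where
  constructor mkJump
  field
    removed₁ : ∣ A ─ B ∣ ≡ 1
    added₁   : ∣ B ─ A ∣ ≡ 1

open Jump

jump⇒∣∣≡ : ∀ {n} {A B : Subset n} → Jump A B → ∣ A ∣ ≡ ∣ B ∣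
jump⇒∣∣≡ {A = A} {B} (mkJump ∣A─B∣≡1 ∣B─A∣≡1) = +-cancelʳ-≡ 1 ∣ A ∣ ∣ B ∣ (begin
  ∣ A ∣ + 1         ≡⟨ cong (∣ A ∣ +_) ∣B─A∣≡1 ⟨
  ∣ A ∣ + ∣ B ─ A ∣ ≡⟨ ∣p∣+∣q─p∣≡∣q∣+∣p─q∣ A B ⟩
  ∣ B ∣ + ∣ A ─ B ∣ ≡⟨ cong (∣ B ∣ +_) ∣A─B∣≡1 ⟩
  ∣ B ∣ + 1         ∎)
  where open ≡-Reasoning

jump⇒exchange : ∀ {n} {A B : Subset n} → Jump A B →
                ∃₂ λ u w → u ∈ A × w ∉ A × B ≡ A [ u ↦ w ]
jump⇒exchange {A = A} {B} (mkJump ∣A─B∣≡1 ∣B─A∣≡1)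
  with ∣p∣≡1⇒p≡⁅x⁆ {p = A ─ B} ∣A─B∣≡1 | ∣p∣≡1⇒p≡⁅x⁆ {p = B ─ A} ∣B─A∣≡1
... | u , A─B≡⁅u⁆ | w , B─A≡⁅w⁆ = u , w , u∈A , w∉A , (begin
  B                              ≡⟨ [p─[p─q]]∪[q─p]≡q A B ⟨
  (A ─ (A ─ B)) ∪ (B ─ A)        ≡⟨ cong₂ (λ X Y → (A ─ X) ∪ Y) A─B≡⁅u⁆ B─A≡⁅w⁆ ⟩
  A [ u ↦ w ]                    ∎)
  where
  open ≡-Reasoning
  u∈A : u ∈ A
  u∈A = p─q⊆p A B (subst (u ∈_) (sym A─B≡⁅u⁆) (x∈⁅x⁆ u))
  w∉A : w ∉ A
  w∉A = x∈p─q⇒x∉q B A (subst (w ∈_) (sym B─A≡⁅w⁆) (x∈⁅x⁆ w))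

exchange⇒jump : ∀ {n} {A : Subset n} {u w} → u ∈ A → w ∉ A → Jump A (A [ u ↦ w ])
exchange⇒jump {n} {A} {u} {w} u∈A w∉A = mkJump
  (trans (cong ∣_∣ (p≡⁅x⁆ u∈A─B only-u)) (∣⁅x⁆∣≡1 u))
  (trans (cong ∣_∣ (p≡⁅x⁆ w∈B─A only-w)) (∣⁅x⁆∣≡1 w))
  where
  B : Subset n
  B = A [ u ↦ w ]
  u∉B : u ∉ B
  u∉B u∈B with ∈-↦⁻ u∈B
  ... | inj₁ (_ , u≢u) = u≢u refl
  ... | inj₂ refl      = w∉A u∈A
  u∈A─B : u ∈ A ─ B
  u∈A─B = x∈p∧x∉q⇒x∈p─q u∈A u∉B
  only-u : ∀ {v} → v ∈ A ─ B → v ≡ u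
  only-u {v} v∈A─B with v ≟ᶠ u
  ... | yes v≡u = v≡u
  ... | no v≢u  = ⊥-elim (x∈p─q⇒x∉q A B v∈A─B (∈-↦⁺ (p─q⊆p A B v∈A─B) v≢u))
  w∈B─A : w ∈ B ─ A
  w∈B─A = x∈p∧x∉q⇒x∈p─q ∈-↦-new w∉A
  only-w : ∀ {v} → v ∈ B ─ A → v ≡ w
  only-w v∈B─A with ∈-↦⁻ (p─q⊆p B A v∈B─A)
  ... | inj₁ (v∈A , _) = ⊥-elim (x∈p─q⇒x∉q B A v∈B─A v∈A)
  ... | inj₂ v≡w       = v≡w

-- Images under permutations and automorphisms

image : ∀ {n} → Permutation′ n → Subset n → Subset n
image η p = tabulate (λ v → lookup p (η ⟨$⟩ˡ v))

module _ {n} (η : Permutation′ n) where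

  lookup-image : ∀ p v → lookup (image η p) v ≡ lookup p (η ⟨$⟩ˡ v)
  lookup-image p = lookup∘tabulate _

  lookup-image-⟨$⟩ʳ : ∀ p v → lookup (image η p) (η ⟨$⟩ʳ v) ≡ lookup p v
  lookup-image-⟨$⟩ʳ p v = trans (lookup-image p _) (cong (lookup p) (inverseˡ η))

  ∈-image⇔ : ∀ {p v} → v ∈ image η p ⇔ η ⟨$⟩ˡ v ∈ p
  ∈-image⇔ {p} {v} = mk⇔
    (λ v∈ → lookup⇒[]= _ p (trans (sym (lookup-image p v)) ([]=⇒lookup v∈)))
    (λ v∈ → lookup⇒[]= v _ (trans (lookup-image p v) ([]=⇒lookup v∈)))

  ∈-image⁺ : ∀ {p v} → v ∈ p → η ⟨$⟩ʳ v ∈ image η p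
  ∈-image⁺ {p} v∈p = from ∈-image⇔ (subst (_∈ p) (sym (inverseˡ η)) v∈p)

  ∉-image⁺ : ∀ {p v} → v ∉ p → η ⟨$⟩ʳ v ∉ image η p
  ∉-image⁺ {p} v∉p ηv∈ = v∉p (subst (_∈ p) (inverseˡ η) (to ∈-image⇔ ηv∈))

  image-zipWith : ∀ f (p q : Subset n) → image η (zipWith f p q) ≡ zipWith f (image η p) (image η q)
  image-zipWith f p q = Pointwise-≡⇒≡ (ext λ v → begin
    lookup (image η (zipWith f p q)) v                ≡⟨ lookup-image (zipWith f p q) v ⟩
    lookup (zipWith f p q) (η ⟨$⟩ˡ v)                 ≡⟨ lookup-zipWith f _ p q ⟩
    f (lookup p (η ⟨$⟩ˡ v)) (lookup q (η ⟨$⟩ˡ v))     ≡⟨ cong₂ f (lookup-image p v) (lookup-image q v) ⟨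
    f (lookup (image η p) v) (lookup (image η q) v)   ≡⟨ lookup-zipWith f v (image η p) (image η q) ⟨
    lookup (zipWith f (image η p) (image η q)) v      ∎)
    where open ≡-Reasoning

  image-⁅⁆ : ∀ w → image η ⁅ w ⁆ ≡ ⁅ η ⟨$⟩ʳ w ⁆
  image-⁅⁆ w = p≡⁅x⁆ (∈-image⁺ (x∈⁅x⁆ w))
    (λ v∈ → trans (sym (inverseʳ η)) (cong (η ⟨$⟩ʳ_) (x∈⁅y⁆⇒x≡y w (to ∈-image⇔ v∈))))

  image-remove : ∀ A u → image η (A - u) ≡ image η A - (η ⟨$⟩ʳ u)
  image-remove A u = trans (image-zipWith _ A ⁅ u ⁆) (cong (image η A ─_) (image-⁅⁆ u))

  image-↦ : ∀ A u w → image η (A [ u ↦ w ]) ≡ image η (A - u) ∪ ⁅ η ⟨$⟩ʳ w ⁆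
  image-↦ A u w = trans (image-zipWith _ (A - u) ⁅ w ⁆) (cong (image η (A - u) ∪_) (image-⁅⁆ w))

  image-fixed : ∀ {p} → (∀ {v} → v ∈ p → η ⟨$⟩ʳ v ≡ v) → image η p ≡ p
  image-fixed {p} fixed = ⊆-antisym ⊆p ⊇p
    where
    ⊆p : ∀ {v} → v ∈ image η p → v ∈ p
    ⊆p v∈ = let x∈p = to ∈-image⇔ v∈ in subst (_∈ p) (trans (sym (fixed x∈p)) (inverseʳ η)) x∈p
    ⊇p : ∀ {v} → v ∈ p → v ∈ image η p
    ⊇p v∈p = subst (_∈ image η p) (fixed v∈p) (∈-image⁺ v∈p)

  image-section : ∀ p → image η (image (flip η) p) ≡ p
  image-section p = Pointwise-≡⇒≡ (ext λ v →
    trans (lookup-image (image (flip η) p) v)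
      (trans (lookup∘tabulate _ (η ⟨$⟩ˡ v)) (cong (lookup p) (inverseʳ η))))

  jump-image : ∀ {A B} → Jump A B → Jump (image η A) (image η B)
  jump-image {A} {B} jmp with jump⇒exchange {A = A} {B} jmp
  ... | u , w , u∈A , w∉A , refl =
    subst (Jump (image η A)) (sym (trans (image-↦ A u w) (cong (_∪ _) (image-remove A u))))
      (exchange⇒jump (∈-image⁺ u∈A) (∉-image⁺ w∉A))

isIn≡lookup : ∀ {n} (v : Fin n) p → isIn v p ≡ lookup p v
isIn≡lookup v p with lookup p v
... | inside  = refl
... | outside = refl

module _ {n c} {G : ColoredGraph n c} {η : Permutation′ n} (aut : IsAutomorphism G η) where
  open IsAutomorphism aut

  private
    isIn-cong : ∀ {v w : Fin n} (p q : Subset n) → lookup p v ≡ lookup q w → isIn v p ≡ isIn w q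
    isIn-cong {v} {w} p q p[v]≡q[w] = trans (isIn≡lookup v p) (trans p[v]≡q[w] (sym (isIn≡lookup w q)))

    ⟨$⟩ʳ-injective : ∀ {x y} → η ⟨$⟩ʳ x ≡ η ⟨$⟩ʳ y → x ≡ y
    ⟨$⟩ʳ-injective ηx≡ηy = trans (sym (inverseˡ η)) (trans (cong (η ⟨$⟩ˡ_) ηx≡ηy) (inverseˡ η))

    ≟-⟨$⟩ʳ : ∀ x y → ⌊ η ⟨$⟩ʳ x ≟ᶠ η ⟨$⟩ʳ y ⌋ ≡ ⌊ x ≟ᶠ y ⌋
    ≟-⟨$⟩ʳ x y = trans (isYes≗does _)
      (trans (does-⇔ (mk⇔ ⟨$⟩ʳ-injective (cong (η ⟨$⟩ʳ_))) (η ⟨$⟩ʳ x ≟ᶠ η ⟨$⟩ʳ y) (x ≟ᶠ y))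
             (sym (isYes≗does _)))

  eval-image : ∀ {a b} (φ : Form c a b) ρ σ →
    eval G φ (Vec.map (η ⟨$⟩ʳ_) ρ) (Vec.map (image η) σ) ≡ eval G φ ρ σ
  eval-image (eq x y) ρ σ rewrite lookup-map x (η ⟨$⟩ʳ_) ρ | lookup-map y (η ⟨$⟩ʳ_) ρ =
    ≟-⟨$⟩ʳ (lookup ρ x) (lookup ρ y)
  eval-image (edge x y) ρ σ rewrite lookup-map x (η ⟨$⟩ʳ_) ρ | lookup-map y (η ⟨$⟩ʳ_) ρ =
    pres-adj (lookup ρ x) (lookup ρ y)
  eval-image (col j x) ρ σ rewrite lookup-map x (η ⟨$⟩ʳ_) ρ =
    isIn-cong (color G j) (color G j) (pres-col j (lookup ρ x))
  eval-image (mem X x) ρ σ rewrite lookup-map x (η ⟨$⟩ʳ_) ρ | lookup-map X (image η) σ =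
    isIn-cong (image η (lookup σ X)) (lookup σ X) (lookup-image-⟨$⟩ʳ η (lookup σ X) (lookup ρ x))
  eval-image (¬f φ)   ρ σ = cong not (eval-image φ ρ σ)
  eval-image (φ ∧f ψ) ρ σ = cong₂ _∧_ (eval-image φ ρ σ) (eval-image ψ ρ σ)
  eval-image (φ ∨f ψ) ρ σ = cong₂ _∨_ (eval-image φ ρ σ) (eval-image ψ ρ σ)
  eval-image (∃v φ) ρ σ =
    any-reindex ∈-allFin (η ⟨$⟩ʳ_) (η ⟨$⟩ˡ_) (λ _ → inverseʳ η) (λ v → eval-image φ (v ∷ ρ) σ)
  eval-image (∀v φ) ρ σ =
    all-reindex ∈-allFin (η ⟨$⟩ʳ_) (η ⟨$⟩ˡ_) (λ _ → inverseʳ η) (λ v → eval-image φ (v ∷ ρ) σ)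
  eval-image (∃s φ) ρ σ =
    any-reindex ∈-allSubsets (image η) (image (flip η)) (image-section η) (λ X → eval-image φ ρ (X ∷ σ))
  eval-image (∀s φ) ρ σ =
    all-reindex ∈-allSubsets (image η) (image (flip η)) (image-section η) (λ X → eval-image φ ρ (X ∷ σ))

  ⊨-image : ∀ {φ X} → G ⊨ φ [ X ] → G ⊨ φ [ image η X ]
  ⊨-image {φ} {X} = trans (eval-image φ [] (X ∷ []))

-- Token-jumping sequences

_◂_ : ∀ {n} → Subset n → (ℕ → Subset n) → ℕ → Subset n
(X ◂ σ) zero    = X
(X ◂ σ) (suc m) = σ m

-- concat p α β lists α 0, …, α (p − 1) and then β 0, β 1, …: α p itself is dropped, so the result extends α
-- only when α p ≡ β 0.
concat : ∀ {n} → ℕ → (ℕ → Subset n) → (ℕ → Subset n) → ℕ → Subset n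
concat zero    α β = β
concat (suc p) α β = α 0 ◂ concat p (α ∘ suc) β

concat-agrees : ∀ {n} p (α β : ℕ → Subset n) → α p ≡ β 0 → ∀ {m} → m ≤ p → concat p α β m ≡ α m
concat-agrees zero    α β αp≡β0 z≤n       = sym αp≡β0
concat-agrees (suc p) α β αp≡β0 z≤n       = refl
concat-agrees (suc p) α β αp≡β0 (s≤s m≤p) = concat-agrees p (α ∘ suc) β αp≡β0 m≤p

concat-+ : ∀ {n} p (α β : ℕ → Subset n) m → concat p α β (p + m) ≡ β m
concat-+ zero    α β m = refl
concat-+ (suc p) α β m = concat-+ p (α ∘ suc) β m

module _ {n c} {G : ColoredGraph n c} {φ : Form c 0 1} where
  open IsTJSeq

  jump : ∀ {X Y ℓ σ} → IsTJSeq G φ X Y ℓ σ → ∀ {i} → i < ℓ → Jump (σ i) (σ (suc i))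
  jump s i<ℓ = mkJump (step₁ s _ i<ℓ) (step₂ s _ i<ℓ)

  ∣∣-invariant : ∀ {X Y ℓ σ} → IsTJSeq G φ X Y ℓ σ → ∀ {m} → m ≤ ℓ → ∣ σ m ∣ ≡ ∣ X ∣
  ∣∣-invariant s {zero}  _    = cong ∣_∣ (start s)
  ∣∣-invariant s {suc m} m<ℓ = trans (sym (jump⇒∣∣≡ (jump s m<ℓ))) (∣∣-invariant s (<⇒≤ m<ℓ))

  IsTJSeq-prefix : ∀ {X Y ℓ σ j} → IsTJSeq G φ X Y ℓ σ → j ≤ ℓ → IsTJSeq G φ X (σ j) j σ
  IsTJSeq-prefix s j≤ℓ = record
    { start = start s
    ; end   = refl
    ; step₁ = λ i i<j → step₁ s i (<-≤-trans i<j j≤ℓ)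
    ; step₂ = λ i i<j → step₂ s i (<-≤-trans i<j j≤ℓ)
    ; sat   = λ i i≤j → sat s i (≤-trans i≤j j≤ℓ)
    }

  IsTJSeq-suffix : ∀ {X Y σ} j {d} → IsTJSeq G φ X Y (j + d) σ → IsTJSeq G φ (σ j) Y d (σ ∘ (_+ j))
  IsTJSeq-suffix {σ = σ} j {d} s = record
    { start = refl
    ; end   = trans (cong σ (+-comm d j)) (end s)
    ; step₁ = λ i i<d → step₁ s (i + j) (shift (+-monoˡ-< j i<d))
    ; step₂ = λ i i<d → step₂ s (i + j) (shift (+-monoˡ-< j i<d))
    ; sat   = λ i i≤d → sat s (i + j) (shift (+-monoˡ-≤ j i≤d))
    }
    where
    shift : ∀ {m} → m ≤ d + j → m ≤ j + d
    shift {m} = subst (m ≤_) (+-comm d j)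

  IsTJSeq-tail : ∀ {X Y ℓ σ} → IsTJSeq G φ X Y (suc ℓ) σ → IsTJSeq G φ (σ 1) Y ℓ (σ ∘ suc)
  IsTJSeq-tail s = record
    { start = refl
    ; end   = end s
    ; step₁ = λ i i<ℓ → step₁ s (suc i) (s≤s i<ℓ)
    ; step₂ = λ i i<ℓ → step₂ s (suc i) (s≤s i<ℓ)
    ; sat   = λ i i≤ℓ → sat s (suc i) (s≤s i≤ℓ)
    }

  IsTJSeq-◂ : ∀ {X Y Z ℓ σ} → G ⊨ φ [ X ] → Jump X Y → IsTJSeq G φ Y Z ℓ σ →
              IsTJSeq G φ X Z (suc ℓ) (X ◂ σ)
  IsTJSeq-◂ {X} {σ = σ} ⊨X X↝Y s = record
    { start = refl
    ; end   = end s
    ; step₁ = λ { zero _ → removed₁ X↝σ0 ; (suc i) (s≤s i<ℓ) → step₁ s i i<ℓ }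
    ; step₂ = λ { zero _ → added₁ X↝σ0 ; (suc i) (s≤s i<ℓ) → step₂ s i i<ℓ }
    ; sat   = λ { zero _ → ⊨X ; (suc i) (s≤s i≤ℓ) → sat s i i≤ℓ }
    }
    where
    X↝σ0 : Jump X (σ 0)
    X↝σ0 = subst (Jump X) (sym (start s)) X↝Y

  IsTJSeq-concat : ∀ {X Y Z p q α β} → IsTJSeq G φ X Y p α → IsTJSeq G φ Y Z q β →
                   IsTJSeq G φ X Z (p + q) (concat p α β)
  IsTJSeq-concat {Z = Z} {p = zero} {q} {β = β} sα sβ =
    subst (λ X → IsTJSeq G φ X Z q β) (trans (sym (end sα)) (start sα)) sβ
  IsTJSeq-concat {Z = Z} {p = suc p} {q} {α} sα sβ =
    subst (λ X → IsTJSeq G φ X Z (suc (p + q)) _) (start sα)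
      (IsTJSeq-◂ (sat sα 0 z≤n) (jump sα (s≤s z≤n)) (IsTJSeq-concat (IsTJSeq-tail sα) sβ))

  IsTJSeq-image : ∀ {η X Y ℓ σ} → IsAutomorphism G η → IsTJSeq G φ X Y ℓ σ →
                  IsTJSeq G φ (image η X) (image η Y) ℓ (image η ∘ σ)
  IsTJSeq-image {η} aut s = record
    { start = cong (image η) (start s)
    ; end   = cong (image η) (end s)
    ; step₁ = λ i i<ℓ → removed₁ (jump-image η (jump s i<ℓ))
    ; step₂ = λ i i<ℓ → added₁ (jump-image η (jump s i<ℓ))
    ; sat   = λ i i≤ℓ → ⊨-image aut {φ} (sat s i i≤ℓ)
    }

  jump? : ∀ (A B : Subset n) → Dec (Jump A B)
  jump? A B = map′ (λ (r , a) → mkJump r a) (λ j → removed₁ j , added₁ j)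
                   ((∣ A ─ B ∣ ≟ 1) ×-dec (∣ B ─ A ∣ ≟ 1))

  Reachable : ℕ → Subset n → Subset n → Set
  Reachable ℓ X Y = ∃ λ σ → IsTJSeq G φ X Y ℓ σ

  reachable? : ∀ ℓ X Y → Dec (Reachable ℓ X Y)
  reachable? zero X Y = map′
    (λ { (refl , ⊨X) → const X , record
           { start = refl ; end = refl ; step₁ = λ _ () ; step₂ = λ _ () ; sat = λ _ _ → ⊨X } })
    (λ (σ , s) → trans (sym (start s)) (end s) , subst (G ⊨ φ [_]) (start s) (sat s 0 z≤n))
    (≡-dec _≟ᵇ_ X Y ×-dec (eval G φ [] (X ∷ []) ≟ᵇ true))
  reachable? (suc ℓ) X Y = map′
    (λ (⊨X , U , X↝U , σ , s) → X ◂ σ , IsTJSeq-◂ ⊨X X↝U s)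
    (λ (σ , s) → subst (G ⊨ φ [_]) (start s) (sat s 0 z≤n) ,
                 σ 1 , subst (λ X → Jump X (σ 1)) (start s) (jump s (s≤s z≤n)) ,
                 σ ∘ suc , IsTJSeq-tail s)
    ((eval G φ [] (X ∷ []) ≟ᵇ true) ×-dec anySubset? (λ U → jump? X U ×-dec reachable? ℓ U Y))

module _ {P : ℕ → Set} (P? : ∀ m → Dec (P m)) where

  private
    search : ∀ m → (∃ λ k → P k × ∀ k′ → P k′ → k ≤ k′) ⊎ (∀ k → k < m → ¬ P k)
    search zero = inj₂ (λ _ ())
    search (suc m) with search m
    ... | inj₁ found = inj₁ found
    ... | inj₂ none with P? m
    ...   | yes Pm = inj₁ (m , Pm , λ k′ Pk′ → ≮⇒≥ (λ k′<m → none k′ k′<m Pk′))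
    ...   | no ¬Pm = inj₂ (λ k k<1+m → [ none k , (λ { refl → ¬Pm }) ]′ (m<1+n⇒m<n∨m≡n k<1+m))

  least-witness : ∀ {m} → P m → ∃ λ k → P k × ∀ k′ → P k′ → k ≤ k′
  least-witness {m} Pm with search (suc m)
  ... | inj₁ found = found
  ... | inj₂ none  = ⊥-elim (none m ≤-refl Pm)

shortest-exists : ∀ {n c} {G : ColoredGraph n c} {φ X Y ℓ σ} → IsTJSeq G φ X Y ℓ σ →
                  ∃₂ λ ℓ′ σ′ → IsShortestTJSeq G φ X Y ℓ′ σ′
shortest-exists {G = G} {φ} {X} {Y} {σ = σ} s
  with least-witness (λ ℓ → reachable? {G = G} {φ} ℓ X Y) (σ , s)
... | ℓ′ , (σ′ , s′) , minimal = ℓ′ , σ′ , s′ , λ ℓ″ σ″ s″ → minimal ℓ″ (σ″ , s″)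

module _ {n c} {G : ColoredGraph n c} {φ : Form c 0 1} {η : Permutation′ n} (aut : IsAutomorphism G η) where
  open IsTJSeq

  module _ {X Y j d σ u w} (s : IsTJSeq G φ X Y (suc (j + d)) σ)
           (σ[1+j]≡ : σ (suc j) ≡ σ j [ u ↦ w ]) (u∈σj : u ∈ σ j) (η[Y]≡Y : image η Y ≡ Y)
           (fixed : ∀ {v} → v ∈ σ j - u → η ⟨$⟩ʳ v ≡ v) (ηw∉σj-u : η ⟨$⟩ʳ w ∉ σ j - u) where

    private
      τ : ℕ → Subset n
      τ = image η ∘ σ ∘ (_+ suc j)

      prefix : IsTJSeq G φ X (σ j) j σ
      prefix = IsTJSeq-prefix s (≤-trans (m≤m+n j d) (n≤1+n _))

      tail : IsTJSeq G φ (image η (σ (suc j))) Y d τ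
      tail = subst (λ Z → IsTJSeq G φ _ Z d τ) η[Y]≡Y (IsTJSeq-image aut (IsTJSeq-suffix (suc j) s))

      η[σ[1+j]]≡ : image η (σ (suc j)) ≡ σ j [ u ↦ η ⟨$⟩ʳ w ]
      η[σ[1+j]]≡ = trans (cong (image η) σ[1+j]≡)
                     (trans (image-↦ η (σ j) u w) (cong (_∪ ⁅ η ⟨$⟩ʳ w ⁆) (image-fixed η fixed)))

    reroute : Reachable {G = G} {φ} (j + d) X Y ⊎
              ∃ λ σ′ → IsTJSeq G φ X Y (suc (j + d)) σ′ × (∀ {m} → m ≤ j → σ′ m ≡ σ m) ×
                       σ′ (suc j) ≡ σ j [ u ↦ η ⟨$⟩ʳ w ]
    reroute with η ⟨$⟩ʳ w ≟ᶠ u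
    ... | yes ηw≡u =
      inj₁ (concat j σ τ , IsTJSeq-concat prefix (subst (λ Z → IsTJSeq G φ Z Y d τ) η[σ[1+j]]≡σj tail))
      where
      η[σ[1+j]]≡σj : image η (σ (suc j)) ≡ σ j
      η[σ[1+j]]≡σj = trans η[σ[1+j]]≡ (trans (cong (σ j [ u ↦_]) ηw≡u) (↦-self u∈σj))
    ... | no ηw≢u =
      inj₂ (σ′ , subst (λ ℓ → IsTJSeq G φ X Y ℓ σ′) (+-suc j d) (IsTJSeq-concat prefix detour) ,
            concat-agrees j σ (σ j ◂ τ) refl ,
            trans (cong σ′ (+-comm 1 j)) (trans (concat-+ j σ (σ j ◂ τ) 1) η[σ[1+j]]≡))
      where
      σ′ : ℕ → Subset n
      σ′ = concat j σ (σ j ◂ τ)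
      ηw∉σj : η ⟨$⟩ʳ w ∉ σ j
      ηw∉σj ηw∈σj = ηw∉σj-u (x∈p∧x≢y⇒x∈p-y ηw∈σj ηw≢u)
      detour : IsTJSeq G φ (σ j) Y (suc d) (σ j ◂ τ)
      detour = IsTJSeq-◂ (sat s j (≤-trans (m≤m+n j d) (n≤1+n _)))
                 (subst (Jump (σ j)) (sym η[σ[1+j]]≡) (exchange⇒jump u∈σj ηw∉σj)) tail

-- Confining a shortest sequence to the classes indexed by I

pigeonhole : ∀ {n t} (C : Fin t → Subset n) → (∀ {i j v} → i ≢ j → v ∈ C i → v ∉ C j) →
             ∀ (I : Subset t) (R : Subset n) → ∣ R ∣ < ∣ I ∣ →
             ∃ λ b → b ∈ I × ∀ {v} → v ∈ C b → v ∉ R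
pigeonhole C disjoint (outside ∷ I) R ∣R∣<∣I∣
  with pigeonhole (C ∘ suc) (λ i≢j → disjoint (i≢j ∘ suc-injective)) I R ∣R∣<∣I∣
... | b , b∈I , misses = suc b , there b∈I , misses
pigeonhole C disjoint (inside ∷ I) R ∣R∣≤∣I∣ with any? (λ v → v ∈? C zero ×-dec v ∈? R)
... | no C₀∩R=∅ = zero , here , λ v∈C₀ v∈R → C₀∩R=∅ (_ , v∈C₀ , v∈R)
... | yes (v , v∈C₀ , v∈R)
  with pigeonhole (C ∘ suc) (λ i≢j → disjoint (i≢j ∘ suc-injective)) I (R - v)
                  (<-≤-trans (x∈p⇒∣p-x∣<∣p∣ v∈R) (≤-pred ∣R∣≤∣I∣))
...   | b , b∈I , misses = suc b , there b∈I ,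
        λ x∈C[b] x∈R → misses x∈C[b] (x∈p∧x≢y⇒x∈p-y x∈R (λ { refl → disjoint (λ ()) v∈C₀ x∈C[b] }))

module SameTypeSwap {n c} {G : ColoredGraph n c} {X Y : Subset n} (st : SameType G X Y) where

  η : Permutation′ n
  η = proj₁ st

  automorphism : IsAutomorphism G η
  automorphism = proj₁ (proj₂ st)

  maps : ∀ {v} → v ∈ X → η ⟨$⟩ʳ v ∈ Y
  maps {v} v∈X = lookup⇒[]= _ Y (trans (proj₁ (proj₂ (proj₂ st)) v) ([]=⇒lookup v∈X))

  fixes : ∀ {v} → v ∉ X → v ∉ Y → η ⟨$⟩ʳ v ≡ v
  fixes {v} v∉X v∉Y = proj₂ (proj₂ (proj₂ (proj₂ st))) v
    (∉⇒lookup≡outside (λ v∈X∪Y → [ v∉X , v∉Y ]′ (x∈p∪q⁻ X Y v∈X∪Y)))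

module Confinement {n c t} (G : ColoredGraph n c) (φ : Form c 0 1) (S S′ : Subset n)
  (C : Fin t → Subset n) (I : Subset t)
  (disjoint : ∀ i j → i ≢ j → C i ∩ C j ≡ ⊥)
  (sameType : ∀ i j → SameType G (C i) (C j))
  (avoid : ∀ i → C i ∩ (S ∪ S′) ≡ ⊥)
  (∣I∣≡∣S∣ : ∣ I ∣ ≡ ∣ S ∣) where

  open IsTJSeq

  Confined : (ℕ → Subset n) → ℕ → Set
  Confined σ j = ∀ i m v → m ≤ j → v ∈ C i → v ∈ σ m → i ∈ I

  private
    C-disjoint : ∀ {i j v} → i ≢ j → v ∈ C i → v ∉ C j
    C-disjoint {i} {j} i≢j v∈C[i] v∈C[j] = ∉⊥ (subst (_ ∈_) (disjoint i j i≢j) (x∈p∩q⁺ (v∈C[i] , v∈C[j])))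

    C∌SS′ : ∀ {i v} → v ∈ C i → v ∉ S ∪ S′
    C∌SS′ {i} v∈C[i] v∈S∪S′ = ∉⊥ (subst (_ ∈_) (avoid i) (x∈p∩q⁺ (v∈C[i] , v∈S∪S′)))

  confined-start : ∀ {σ} → σ 0 ≡ S → Confined σ 0
  confined-start σ0≡S i .0 v z≤n v∈C[i] v∈σ0 =
    ⊥-elim (C∌SS′ v∈C[i] (x∈p∪q⁺ (inj₁ (subst (v ∈_) σ0≡S v∈σ0))))

  confined-suc : ∀ {σ σ′ j x} → Confined σ j → (∀ {m} → m ≤ j → σ′ m ≡ σ m) →
                 (∀ {v} → v ∈ σ′ (suc j) → v ∈ σ j ⊎ v ≡ x) → (∀ {i} → x ∈ C i → i ∈ I) →
                 Confined σ′ (suc j)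
  confined-suc {j = j} conf agree new x-ok i m v m≤1+j v∈C[i] v∈σ′[m] with m≤n⇒m<n∨m≡n m≤1+j
  ... | inj₁ (s≤s m≤j) = conf i m v m≤j v∈C[i] (subst (v ∈_) (agree m≤j) v∈σ′[m])
  ... | inj₂ refl with new v∈σ′[m]
  ...   | inj₁ v∈σ[j] = conf i j v ≤-refl v∈C[i] v∈σ[j]
  ...   | inj₂ refl    = x-ok v∈C[i]

  private
    module Redirect {j d σ u w i b}
      (s : IsTJSeq G φ S S′ (suc (j + d)) σ)
      (minimal : ∀ ℓ′ σ′ → IsTJSeq G φ S S′ ℓ′ σ′ → suc (j + d) ≤ ℓ′)
      (conf : Confined σ j) (σ[1+j]≡ : σ (suc j) ≡ σ j [ u ↦ w ]) (u∈σj : u ∈ σ j)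
      (w∈C[i] : w ∈ C i) (i∉I : i ∉ I) (b∈I : b ∈ I) (C[b]∌ : ∀ {v} → v ∈ C b → v ∉ σ j - u) where

      open SameTypeSwap {X = C i} {C b} (sameType i b)

      ηw∈C[b] : η ⟨$⟩ʳ w ∈ C b
      ηw∈C[b] = maps w∈C[i]

      fixed : ∀ {v} → v ∈ σ j - u → η ⟨$⟩ʳ v ≡ v
      fixed {v} v∈ = fixes (λ v∈C[i] → i∉I (conf i j v ≤-refl v∈C[i] (p─q⊆p (σ j) ⁅ u ⁆ v∈)))
                           (λ v∈C[b] → C[b]∌ v∈C[b] v∈)

      η[S′]≡S′ : image η S′ ≡ S′
      η[S′]≡S′ = image-fixed η (λ v∈S′ → fixes (λ v∈C[i] → C∌SS′ v∈C[i] (x∈p∪q⁺ (inj₂ v∈S′)))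
                                                (λ v∈C[b] → C∌SS′ v∈C[b] (x∈p∪q⁺ (inj₂ v∈S′))))

      ηw∈C⇒∈I : ∀ {i′} → η ⟨$⟩ʳ w ∈ C i′ → i′ ∈ I
      ηw∈C⇒∈I {i′} ηw∈C[i′] with i′ ≟ᶠ b
      ... | yes refl  = b∈I
      ... | no i′≢b   = ⊥-elim (C-disjoint i′≢b ηw∈C[i′] ηw∈C[b])

      redirected : ∃ λ σ′ → IsShortestTJSeq G φ S S′ (suc (j + d)) σ′ × Confined σ′ (suc j)
      redirected with reroute automorphism s σ[1+j]≡ u∈σj η[S′]≡S′ fixed (λ ηw∈ → C[b]∌ ηw∈C[b] ηw∈)
      ... | inj₁ (σ″ , shorter) = ⊥-elim (1+n≰n (minimal _ σ″ shorter))
      ... | inj₂ (σ′ , s′ , agree , σ′[1+j]≡) = σ′ , (s′ , minimal) ,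
            confined-suc conf agree (λ v∈ → map₁ proj₁ (∈-↦⁻ (subst (_ ∈_) σ′[1+j]≡ v∈))) ηw∈C⇒∈I

  extend : ∀ {ℓ σ j} → IsShortestTJSeq G φ S S′ ℓ σ → j < ℓ → Confined σ j →
           ∃ λ σ′ → IsShortestTJSeq G φ S S′ ℓ σ′ × Confined σ′ (suc j)
  extend {σ = σ} {j} (s , minimal) j<ℓ conf with jump⇒exchange (jump s j<ℓ)
  ... | u , w , u∈σj , _ , σ[1+j]≡ with any? (λ i → w ∈? C i ×-dec ¬? (i ∈? I))
  ... | no w-allowed = σ , (s , minimal) ,
        confined-suc conf (λ _ → refl) (λ v∈ → map₁ proj₁ (∈-↦⁻ (subst (_ ∈_) σ[1+j]≡ v∈)))
          (λ {i} w∈C[i] → decidable-stable (i ∈? I) (λ i∉I → w-allowed (i , w∈C[i] , i∉I)))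
  ... | yes (i , w∈C[i] , i∉I)
    with m≤n⇒∃[o]m+o≡n j<ℓ
       | pigeonhole C C-disjoint I (σ j - u)
           (subst (∣ σ j - u ∣ <_) (trans (∣∣-invariant s (<⇒≤ j<ℓ)) (sym ∣I∣≡∣S∣)) (x∈p⇒∣p-x∣<∣p∣ u∈σj))
  ...   | d , refl | b , b∈I , C[b]∌ =
    Redirect.redirected s minimal conf σ[1+j]≡ u∈σj w∈C[i] i∉I b∈I C[b]∌

  confine : ∀ {ℓ σ} → IsShortestTJSeq G φ S S′ ℓ σ → ∀ j → j ≤ ℓ →
            ∃ λ σ′ → IsShortestTJSeq G φ S S′ ℓ σ′ × Confined σ′ j
  confine shortest zero    _   = _ , shortest , confined-start (start (proj₁ shortest))
  confine shortest (suc j) j<ℓ with confine shortest j (<⇒≤ j<ℓ)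
  ... | σ′ , shortest′ , conf = extend shortest′ j<ℓ conf

lemma4p2 : ∀ {n c} (G : ColoredGraph n c) (φ : Form c 0 1) (S S' : Subset n) (k : ℕ) →
    YesInstance G φ S S' → ∣ S ∣ ≡ k → ∣ S' ∣ ≡ k →
    (t : ℕ) (C : Fin t → Subset n) →
    (∀ i j → i ≢ j → C i ∩ C j ≡ ⊥) →
    (∀ i j → SameType G (C i) (C j)) →
    (∀ i → C i ∩ (S ∪ S') ≡ ⊥) →
    k < t →
    (I : Subset t) → ∣ I ∣ ≡ k →
    ∃ λ ℓ → ∃ λ (σ : ℕ → Subset n) →
      IsShortestTJSeq G φ S S' ℓ σ ×
      (∀ i j v → j ≤ ℓ → v ∈ C i → v ∈ σ j → i ∈ I)
-- k < t only guarantees that some I with ∣ I ∣ ≡ k exists.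
lemma4p2 G φ S S' k (_ , _ , _ , s) ∣S∣≡k _ t C disjoint sameType avoid _ I ∣I∣≡k =
  let ℓ , _ , shortest = shortest-exists s
      σ , shortest′ , confined = confine shortest ℓ ≤-refl
  in ℓ , σ , shortest′ , confined
  where open Confinement G φ S S' C I disjoint sameType avoid (trans ∣I∣≡k (sym ∣S∣≡k))
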